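{- Let $G=(V,E)$ be a flow graph (a DAG with a positive flow $f(e)>0$ on every edge, satisfying conservation of flow at every vertex that is neither a source nor a sink). Let $P=(u_1,\dots,u_k)$, $k\ge 2$, be a path in $G$ and let $w>0$. Then $P$ is $w$-safe if and only if its excess flow satisfies $f_P\ge w$.
   Context: For a vertex $u$, $f_{in}(u)$ and $f_{out}(u)$ denote the total flow on the incoming and on the outgoing edges of $u$. A vertex $v$ is a source if $f_{in}(v)=0$ and a sink if $f_{out}(v)=0$; every other vertex satisfies $f_{in}(v)=f_{out}(v)$. A flow decomposition of $G$ is a set $\mathcal{P}_f$ of paths in $G$, each going from a source to a sink and carrying a positive weight, such that for every edge $e$ the flow $f(e)$ equals the sum of the weights of the paths of $\mathcal{P}_f$ containing $e$. A path $P$ is $w$-safe if in every flow decomposition $\mathcal{P}_f$ of $G$, $P$ is a subpath of paths of $\mathcal{P}_f$ whose total weight is at least $w$. The excess flow of $P=(u_1,\dots,u_k)$ is $f_P = f(u_1,u_2) - \sum_{i=2}^{k-1}\sum_{v\neq u_{i+1}} f(u_i,v)$, where the inner sum is over all out-neighbours $v$ of $u_i$ other than $u_{i+1}$; equivalently $f_P=\sum_{i=1}^{k-1} f(u_i,u_{i+1})-\sum_{i=2}^{k-1} f_{out}(u_i)=\sum_{i=1}^{k-1} f(u_i,u_{i+1})-\sum_{i=2}^{k-1} f_{in}(u_i)$.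
   Formalization: The flow values $f(e)$, the weights of the paths in every flow decomposition, and the bound $w$ are all rational. -}

module Defs where

open import Data.Nat using (ℕ)
open import Data.Fin using (Fin)
open import Data.Fin.Properties using (_≟_)
open import Data.Rational using (ℚ; 0ℚ; _+_; _-_; _≤_; _<_)
open import Data.List using (List; []; _∷_; [_]; _++_; head; foldr; map; filter; allFin; last)
open import Data.List.Relation.Binary.Infix.Heterogeneous using (Infix)
open import Data.List.Relation.Binary.Infix.Heterogeneous.Properties using (infix?)
open import Data.List.Relation.Unary.All using (All)
open import Data.Maybe using (Maybe; just; nothing)
open import Data.Product using (_×_; _,_; proj₁; proj₂; ∃)
open import Data.Unit using (⊤)
open import Data.Empty using (⊥)
open import Relation.Binary.PropositionalEquality using (_≡_; _≢_)
open import Relation.Nullary using (¬_)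
open import Relation.Nullary.Decidable using (¬?)

Σℚ : List ℚ → ℚ
Σℚ = foldr _+_ 0ℚ

Σ[all] : ∀ {n} → (Fin n → ℚ) → ℚ
Σ[all] {n} g = Σℚ (map g (allFin n))

IsWalk : ∀ {n} → (Fin n → Fin n → Set) → List (Fin n) → Set
IsWalk E []            = ⊥
IsWalk E (x ∷ [])      = ⊤
IsWalk E (x ∷ y ∷ r)   = E x y × IsWalk E (y ∷ r)

Subpath : ∀ {n} → List (Fin n) → List (Fin n) → Set
Subpath P Q = Infix _≡_ P Q

-- The flow is a function on all ordered
-- pairs; the edges are exactly the pairs carrying positive flow (non-edges
-- carry flow 0), so "f(e) > 0 on every edge" holds by construction.
record FlowGraph (n : ℕ) : Set where
  field
    f       : Fin n → Fin n → ℚ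
    nonneg  : ∀ u v → 0ℚ ≤ f u v

  Edge : Fin n → Fin n → Set
  Edge u v = 0ℚ < f u v

  fin : Fin n → ℚ
  fin v = Σ[all] (λ u → f u v)

  fout : Fin n → ℚ
  fout u = Σ[all] (λ v → f u v)

  IsSource : Fin n → Set
  IsSource v = fin v ≡ 0ℚ

  IsSink : Fin n → Set
  IsSink v = fout v ≡ 0ℚ

  field
    acyclic      : ∀ v (W : List (Fin n)) → ¬ IsWalk Edge (v ∷ (W ++ [ v ]))
    conservation : ∀ v → ¬ IsSource v → ¬ IsSink v → fin v ≡ fout v

module _ {n : ℕ} (G : FlowGraph n) where
  open FlowGraph G

  -- A source-to-sink path of G: a walk whose first vertex is a source and
  -- whose last vertex is a sink (walks in a DAG are paths).
  IsSourceSinkPath : List (Fin n) → Set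
  IsSourceSinkPath Q =
    IsWalk Edge Q
    × (∀ s → head Q ≡ just s → IsSource s)
    × (∀ t → last Q ≡ just t → IsSink t)

  weightContaining : List (List (Fin n) × ℚ) → List (Fin n) → ℚ
  weightContaining D P =
    Σℚ (map proj₂ (filter (λ q → infix? _≟_ P (proj₁ q)) D))

  IsFlowDecomposition : List (List (Fin n) × ℚ) → Set
  IsFlowDecomposition D =
    All (λ q → IsSourceSinkPath (proj₁ q) × 0ℚ < proj₂ q) D
    × (∀ u v → f u v ≡ weightContaining D (u ∷ v ∷ []))

  WSafe : ℚ → List (Fin n) → Set
  WSafe w P = ∀ D → IsFlowDecomposition D → w ≤ weightContaining D P

  outExcept : Fin n → Fin n → ℚ
  outExcept u y = Σℚ (map (f u) (filter (λ v → ¬? (v ≟ y)) (allFin n)))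

  -- Σ_{i=2}^{k-1} Σ_{v ≠ u_{i+1}} f(u_i, v), given the list (u_2, ..., u_k).
  leak : List (Fin n) → ℚ
  leak (x ∷ y ∷ r) = outExcept x y + leak (y ∷ r)
  leak _           = 0ℚ

  excessFlow : List (Fin n) → ℚ
  excessFlow (x ∷ y ∷ r) = f x y - leak (y ∷ r)
  excessFlow _           = 0ℚ

{-# OPTIONS --safe #-}
module Submission where

-- Excess is additive in the flow. In a decomposition, a single path q of weight w contributes
-- at most w to the excess of P, and only when P lies on q: once a walk along P leaves q at a
-- vertex, the leak at that vertex already absorbs all of w. So f_P is at most the weight of the
-- paths containing P, which gives safety when f_P ≥ w.
--
-- Conversely a decomposition is built greedily: peel off a source-to-sink path carrying the
-- bottleneck value ε of the remaining flow, which kills at least one positive edge. If P carries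
-- remaining flow and has no leak, route the path along P; this lowers both the excess of P and
-- the weight still allowed on P by ε. Otherwise route it along P up to its last leak and out
-- through it; the excess of P is unchanged and P gets no weight. If P no longer carries flow on
-- some edge, no later path contains P. The paths containing P thus get total weight at most
-- max(0, f_P), so P is not w-safe when f_P < w.

open import Data.Empty using (⊥-elim)
open import Data.Fin using (Fin)
open import Data.Fin.Induction using (spo-wellFounded; spo-noetherian)
open import Data.Fin.Properties using (_≟_; any?)
open import Data.List using (List; []; _∷_; _++_; map; filter; allFin; head; last; length; cartesianProduct)
open import Data.List.Membership.Propositional using (_∈_)
open import Data.List.Membership.Propositional.Properties
  using (∈-allFin; ∈-filter⁺; ∈-filter⁻; ∈-cartesianProduct⁺)
import Data.List.Membership.DecPropositional as DecMembership
open import Data.List.Properties using (++-assoc)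
open import Data.List.Relation.Binary.Infix.Heterogeneous using (Infix; here; there; _++ⁱ_)
open import Data.List.Relation.Binary.Infix.Heterogeneous.Properties
  using (infix?; Prefix-Infix-trans; fromPrefixSuffix) renaming (trans to Infix-trans)
open import Data.List.Relation.Binary.Pointwise.Base using ([]; _∷_)
import Data.List.Relation.Binary.Pointwise.Properties as Pointwise
open import Data.List.Relation.Binary.Prefix.Heterogeneous using (Prefix; []; _∷_)
open import Data.List.Relation.Binary.Suffix.Heterogeneous as Suffix using (Suffix; here; there)
open import Data.List.Relation.Unary.All using (All; []; _∷_)
import Data.List.Relation.Unary.All as All
open import Data.List.Relation.Unary.AllPairs using ([]; _∷_)
open import Data.List.Relation.Unary.Any using (here; there)
open import Data.List.Relation.Unary.Unique.Propositional using (Unique)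
open import Data.List.Relation.Unary.Unique.Propositional.Properties using (allFin⁺; filter⁺)
open import Data.Maybe using (just)
open import Data.Nat as ℕ using (ℕ)
import Data.Nat.Induction as ℕ
import Data.Nat.Properties as ℕ
open import Data.Product using (Σ; ∃; ∃₂; _×_; _,_; proj₁; proj₂)
open import Data.Rational using (ℚ; 0ℚ; _+_; _-_; -_; _≤_; _<_; _⊓_; _⊔_)
import Data.Rational.Properties as ℚ
open import Algebra.Properties.Group ℚ.+-0-group using (∙-cancelˡ)
open import Data.Rational.Solver using (module +-*-Solver)
open import Data.Sum as Sum using (_⊎_; inj₁; inj₂)
open import Data.Unit using (⊤; tt)
open import Function using (_∘′_; flip)
open import Function.Bundles using (_⇔_; mk⇔)
open import Induction.WellFounded using (WellFounded; Acc; acc; module Subrelation)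
import Induction.WellFounded as WF
open import Level using (0ℓ)
open import Relation.Binary.Construct.Closure.Transitive as TransClosure using (TransClosure; [_]; _∷_)
import Relation.Binary.Construct.On as On
open import Relation.Binary.PropositionalEquality hiding ([_])
open import Relation.Binary.Structures using (IsStrictPartialOrder)
open import Relation.Nullary using (¬_; Dec; yes; no)
open import Relation.Nullary.Decidable using (¬?; _×-dec_)
import Relation.Unary as U

open import Defs

open +-*-Solver

p-q≤p : ∀ {p q} → 0ℚ ≤ q → p - q ≤ p
p-q≤p {p} 0≤q = ℚ.≤-trans (ℚ.+-monoʳ-≤ p (ℚ.neg-antimono-≤ 0≤q)) (ℚ.≤-reflexive (ℚ.+-identityʳ p))

p≤q⇒p-q≤0 : ∀ {p q} → p ≤ q → p - q ≤ 0ℚ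
p≤q⇒p-q≤0 {p} p≤q = ℚ.≤-trans (ℚ.+-monoʳ-≤ p (ℚ.neg-antimono-≤ p≤q)) (ℚ.≤-reflexive (ℚ.+-inverseʳ p))

p≤q⇒0≤q-p : ∀ {p q} → p ≤ q → 0ℚ ≤ q - p
p≤q⇒0≤q-p {p} p≤q = ℚ.≤-trans (ℚ.≤-reflexive (sym (ℚ.+-inverseʳ p))) (ℚ.+-monoˡ-≤ (- p) p≤q)

p+q≤r⇒q≤r-p : ∀ {p q r} → p + q ≤ r → q ≤ r - p
p+q≤r⇒q≤r-p {p} {q} p+q≤r = ℚ.≤-trans
  (ℚ.≤-reflexive (solve 2 (λ p q → q := (p :+ q) :- p) refl p q)) (ℚ.+-monoˡ-≤ (- p) p+q≤r)

p≤p+q : ∀ {p q} → 0ℚ ≤ q → p ≤ p + q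
p≤p+q {p} 0≤q = ℚ.≤-trans (ℚ.≤-reflexive (sym (ℚ.+-identityʳ p))) (ℚ.+-monoʳ-≤ p 0≤q)

q≤p+q : ∀ {p q} → 0ℚ ≤ p → q ≤ p + q
q≤p+q {q = q} 0≤p = ℚ.≤-trans (ℚ.≤-reflexive (sym (ℚ.+-identityˡ q))) (ℚ.+-monoˡ-≤ q 0≤p)

module _ {A : Set} where

  sumOf : (A → ℚ) → List A → ℚ
  sumOf a xs = Σℚ (map a xs)

  sumOf-cong : ∀ {a b : A → ℚ} xs → (∀ x → a x ≡ b x) → sumOf a xs ≡ sumOf b xs
  sumOf-cong []       a≡b = refl
  sumOf-cong (x ∷ xs) a≡b = cong₂ _+_ (a≡b x) (sumOf-cong xs a≡b)

  sumOf-+ : ∀ (a b : A → ℚ) xs → sumOf (λ x → a x + b x) xs ≡ sumOf a xs + sumOf b xs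
  sumOf-+ a b []       = sym (ℚ.+-identityˡ 0ℚ)
  sumOf-+ a b (x ∷ xs) = begin
    (a x + b x) + sumOf (λ x → a x + b x) xs  ≡⟨ cong (a x + b x +_) (sumOf-+ a b xs) ⟩
    (a x + b x) + (sumOf a xs + sumOf b xs)   ≡⟨ solve 4 (λ p q r s → (p :+ q) :+ (r :+ s) := (p :+ r) :+ (q :+ s))
                                                   refl (a x) (b x) (sumOf a xs) (sumOf b xs) ⟩
    (a x + sumOf a xs) + (b x + sumOf b xs)   ∎
    where open ≡-Reasoning

  sumOf-nonneg : ∀ {a : A → ℚ} xs → (∀ x → 0ℚ ≤ a x) → 0ℚ ≤ sumOf a xs
  sumOf-nonneg []       a≥0 = ℚ.≤-refl
  sumOf-nonneg (x ∷ xs) a≥0 = ℚ.+-mono-≤ (a≥0 x) (sumOf-nonneg xs a≥0)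

  ≤-sumOf : ∀ {a : A → ℚ} {xs y} → (∀ x → 0ℚ ≤ a x) → y ∈ xs → a y ≤ sumOf a xs
  ≤-sumOf {xs = x ∷ xs} a≥0 (here refl)  = p≤p+q (sumOf-nonneg xs a≥0)
  ≤-sumOf {xs = x ∷ xs} a≥0 (there y∈xs) = ℚ.≤-trans (≤-sumOf a≥0 y∈xs) (q≤p+q (a≥0 x))

  sumOf-≡0 : ∀ {a : A → ℚ} xs → (∀ {x} → x ∈ xs → a x ≡ 0ℚ) → sumOf a xs ≡ 0ℚ
  sumOf-≡0 []       a≡0 = refl
  sumOf-≡0 (x ∷ xs) a≡0 = cong₂ _+_ (a≡0 (here refl)) (sumOf-≡0 xs (a≡0 ∘′ there))

  sumOf-≡-single : ∀ {a : A → ℚ} {xs y} → Unique xs → y ∈ xs →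
                   (∀ {x} → x ∈ xs → x ≢ y → a x ≡ 0ℚ) → sumOf a xs ≡ a y
  sumOf-≡-single {a} {x ∷ xs} (x∉xs ∷ _) (here refl) a≡0 =
    trans (cong (a x +_) (sumOf-≡0 xs λ z∈xs → a≡0 (there z∈xs) λ { refl → All.lookup x∉xs z∈xs refl }))
          (ℚ.+-identityʳ (a x))
  sumOf-≡-single {a} {x ∷ xs} (x∉xs ∷ xs!) (there y∈xs) a≡0 =
    trans (cong (_+ sumOf a xs) (a≡0 (here refl) λ { refl → All.lookup x∉xs y∈xs refl }))
          (trans (ℚ.+-identityˡ _) (sumOf-≡-single xs! y∈xs (a≡0 ∘′ there)))

  sumOf-pos⇒term-pos : ∀ {a : A → ℚ} xs → 0ℚ < sumOf a xs → ∃ λ x → 0ℚ < a x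
  sumOf-pos⇒term-pos []       0<0 = ⊥-elim (ℚ.<-irrefl refl 0<0)
  sumOf-pos⇒term-pos {a} (x ∷ xs) 0<Σ with 0ℚ ℚ.<? a x
  ... | yes 0<ax = x , 0<ax
  ... | no  0≮ax = sumOf-pos⇒term-pos xs (ℚ.<-≤-trans 0<Σ
        (ℚ.≤-trans (ℚ.+-monoˡ-≤ (sumOf a xs) (ℚ.≮⇒≥ 0≮ax)) (ℚ.≤-reflexive (ℚ.+-identityˡ _))))

module _ {A : Set} where

  infix 4 _⟶_∈_

  _⟶_∈_ : A → A → List A → Set
  a ⟶ b ∈ Q = Infix _≡_ (a ∷ b ∷ []) Q

  Infix-∷⁻ : ∀ {a : A} {L Q} → Infix _≡_ (a ∷ L) Q → Infix _≡_ L Q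
  Infix-∷⁻ (here (_ ∷ p)) = there (here p)
  Infix-∷⁻ (there i)      = there (Infix-∷⁻ i)

  Infix⇒∈ : ∀ {a : A} {L Q} → Infix _≡_ (a ∷ L) Q → a ∈ Q
  Infix⇒∈ (here (refl ∷ _)) = here refl
  Infix⇒∈ (there i)         = there (Infix⇒∈ i)

  Infix⇒⟶ : ∀ {a b : A} {L Q} → Infix _≡_ (a ∷ b ∷ L) Q → a ⟶ b ∈ Q
  Infix⇒⟶ = Prefix-Infix-trans trans (refl ∷ refl ∷ [])

  ⟶⇒Suffix : ∀ {a b : A} {Q} → a ⟶ b ∈ Q → ∃ λ R → Suffix _≡_ (a ∷ b ∷ R) Q
  ⟶⇒Suffix {Q = _ ∷ _ ∷ R} (here (refl ∷ refl ∷ [])) = R , here (Pointwise.refl refl)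
  ⟶⇒Suffix (there i) with ⟶⇒Suffix i
  ... | R , s = R , there s

  Suffix⇒⟶ : ∀ {a b : A} {R Q} → Suffix _≡_ (a ∷ b ∷ R) Q → a ⟶ b ∈ Q
  Suffix⇒⟶ = fromPrefixSuffix trans (refl ∷ refl ∷ [])

  Suffix⇒last : ∀ {t : A} {Q} → Suffix _≡_ (t ∷ []) Q → last Q ≡ just t
  Suffix⇒last (here (refl ∷ []))     = refl
  Suffix⇒last (there {bs = _ ∷ _} s) = Suffix⇒last s
  Suffix⇒last (there {bs = []} (here ()))

  ⟶⇒∈-tail : ∀ {x a q : A} {Q} → x ⟶ a ∈ q ∷ Q → a ∈ Q
  ⟶⇒∈-tail (here (_ ∷ refl ∷ [])) = here refl
  ⟶⇒∈-tail (there i)              = Infix⇒∈ (Infix-∷⁻ i)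

  Prefix-++ : ∀ (L B : List A) → Prefix _≡_ L (L ++ B)
  Prefix-++ []      B = []
  Prefix-++ (x ∷ L) B = refl ∷ Prefix-++ L B

  successor-unique : ∀ {Q : List A} → Unique Q → ∀ {a x y} → a ⟶ x ∈ Q → a ⟶ y ∈ Q → x ≡ y
  successor-unique _        (here (refl ∷ refl ∷ [])) (here (refl ∷ refl ∷ [])) = refl
  successor-unique (a∉ ∷ _) (here (refl ∷ _))         (there j)         = ⊥-elim (All.lookup a∉ (Infix⇒∈ j) refl)
  successor-unique (a∉ ∷ _) (there i)                 (here (refl ∷ _)) = ⊥-elim (All.lookup a∉ (Infix⇒∈ i) refl)
  successor-unique (_ ∷ Q!) (there i)                 (there j)         = successor-unique Q! i j

  predecessor-unique : ∀ {Q : List A} → Unique Q → ∀ {a x y} → x ⟶ a ∈ Q → y ⟶ a ∈ Q → x ≡ y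
  predecessor-unique _ (here (refl ∷ refl ∷ [])) (here (refl ∷ refl ∷ [])) = refl
  predecessor-unique (_ ∷ a∉ ∷ _) (here (refl ∷ refl ∷ [])) (there j) =
    ⊥-elim (All.lookup a∉ (⟶⇒∈-tail j) refl)
  predecessor-unique (_ ∷ a∉ ∷ _) (there i) (here (refl ∷ refl ∷ [])) =
    ⊥-elim (All.lookup a∉ (⟶⇒∈-tail i) refl)
  predecessor-unique (_ ∷ Q!) (there i) (there j) = predecessor-unique Q! i j
  predecessor-unique (_ ∷ []) (there i) (here (_ ∷ ()))

  predecessor-exists : ∀ {a v : A} {R} → v ∈ R → ∃ λ p → p ⟶ v ∈ a ∷ R
  predecessor-exists {a} (here refl) = a , here (refl ∷ refl ∷ [])
  predecessor-exists {R = r ∷ _} (there v∈R) with predecessor-exists {a = r} v∈R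
  ... | p , i = p , there i

  successor-exists : ∀ {v : A} {Q} → v ∈ Q → last Q ≢ just v → ∃ λ s → v ⟶ s ∈ Q
  successor-exists {Q = x ∷ []}     (here refl) last≢v = ⊥-elim (last≢v refl)
  successor-exists {Q = x ∷ y ∷ _}  (here refl) _      = y , here (refl ∷ refl ∷ [])
  successor-exists {Q = x ∷ y ∷ _}  (there v∈Q) last≢v with successor-exists v∈Q last≢v
  ... | s , i = s , there i

module _ {n : ℕ} {E : Fin n → Fin n → Set} where

  IsWalk-map : ∀ {E′ : Fin n → Fin n → Set} → (∀ {a b} → E a b → E′ a b) →
               ∀ {L} → IsWalk E L → IsWalk E′ L
  IsWalk-map E⇒E′ {_ ∷ []}    _         = tt
  IsWalk-map E⇒E′ {_ ∷ _ ∷ _} (e , wlk) = E⇒E′ e , IsWalk-map E⇒E′ wlk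

  IsWalk-⟶ : ∀ {Q a b} → IsWalk E Q → a ⟶ b ∈ Q → E a b
  IsWalk-⟶ {_ ∷ _ ∷ _} (e , _)   (here (refl ∷ refl ∷ [])) = e
  IsWalk-⟶ {_ ∷ _ ∷ _} (_ , wlk) (there i)                 = IsWalk-⟶ wlk i
  IsWalk-⟶ {_ ∷ []}    _         (here (_ ∷ ()))
  IsWalk-⟶ {_ ∷ []}    _         (there (here ()))

  walk-or-gap : (∀ u v → Dec (E u v)) → ∀ x r →
                IsWalk E (x ∷ r) ⊎ ∃₂ λ s t → ¬ E s t × s ⟶ t ∈ x ∷ r
  walk-or-gap E? x []      = inj₁ tt
  walk-or-gap E? x (y ∷ r) with E? x y | walk-or-gap E? y r
  ... | no ¬e | _                     = inj₂ (x , y , ¬e , here (refl ∷ refl ∷ []))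
  ... | yes e | inj₁ wlk              = inj₁ (e , wlk)
  ... | yes e | inj₂ (s , t , ¬e , i) = inj₂ (s , t , ¬e , there i)

module _ {A : Set} {P Q : A → Set} (P? : U.Decidable P) (Q? : U.Decidable Q) (P⇒Q : ∀ {x} → P x → Q x) where

  length-filter-≤ : ∀ xs → length (filter P? xs) ℕ.≤ length (filter Q? xs)
  length-filter-≤ []       = ℕ.z≤n
  length-filter-≤ (x ∷ xs) with P? x | Q? x
  ... | yes _  | yes _  = ℕ.s≤s (length-filter-≤ xs)
  ... | yes Px | no ¬Qx = ⊥-elim (¬Qx (P⇒Q Px))
  ... | no _   | yes _  = ℕ.m≤n⇒m≤1+n (length-filter-≤ xs)
  ... | no _   | no _   = length-filter-≤ xs

  length-filter-< : ∀ {xs y} → y ∈ xs → Q y → ¬ P y → length (filter P? xs) ℕ.< length (filter Q? xs)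
  length-filter-< {x ∷ xs} (here refl) Qx ¬Px with P? x | Q? x
  ... | yes Px | _      = ⊥-elim (¬Px Px)
  ... | no _   | yes _  = ℕ.s≤s (length-filter-≤ xs)
  ... | no _   | no ¬Qx = ⊥-elim (¬Qx Qx)
  length-filter-< {x ∷ xs} (there y∈xs) Qy ¬Py with P? x | Q? x
  ... | yes _  | yes _  = ℕ.s≤s (length-filter-< y∈xs Qy ¬Py)
  ... | yes Px | no ¬Qx = ⊥-elim (¬Qx (P⇒Q Px))
  ... | no _   | yes _  = ℕ.m≤n⇒m≤1+n (length-filter-< y∈xs Qy ¬Py)
  ... | no _   | no _   = length-filter-< y∈xs Qy ¬Py

Flow : ℕ → Set
Flow n = Fin n → Fin n → ℚ

module _ {n : ℕ} where

  infixl 6 _⊕_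

  _⊕_ : Flow n → Flow n → Flow n
  (g ⊕ h) u v = g u v + h u v

  inflow : Flow n → Fin n → ℚ
  inflow g v = Σ[all] λ u → g u v

  outflow : Flow n → Fin n → ℚ
  outflow g u = Σ[all] (g u)

  others : Fin n → List (Fin n)
  others y = filter (λ v → ¬? (v ≟ y)) (allFin n)

  ∈-others⁺ : ∀ {x y} → x ≢ y → x ∈ others y
  ∈-others⁺ {x} = ∈-filter⁺ (λ v → ¬? (v ≟ _)) (∈-allFin x)

  ∈-others⁻ : ∀ {x y} → x ∈ others y → x ≢ y
  ∈-others⁻ {y = y} x∈ = proj₂ (∈-filter⁻ (λ v → ¬? (v ≟ y)) {xs = allFin n} x∈)

  others-unique : ∀ y → Unique (others y)
  others-unique y = filter⁺ (λ v → ¬? (v ≟ y)) (allFin⁺ n)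

  -- Defs' leak and excessFlow, for an arbitrary flow g instead of the flow of a graph.
  leakOf : Flow n → List (Fin n) → ℚ
  leakOf g (x ∷ y ∷ r) = sumOf (g x) (others y) + leakOf g (y ∷ r)
  leakOf g _           = 0ℚ

  excessOf : Flow n → List (Fin n) → ℚ
  excessOf g (x ∷ y ∷ r) = g x y - leakOf g (y ∷ r)
  excessOf g _           = 0ℚ

  leakOf-cong : ∀ {g h : Flow n} → (∀ u v → g u v ≡ h u v) → ∀ L → leakOf g L ≡ leakOf h L
  leakOf-cong g≡h (x ∷ y ∷ r) = cong₂ _+_ (sumOf-cong (others y) (g≡h x)) (leakOf-cong g≡h (y ∷ r))
  leakOf-cong g≡h []          = refl
  leakOf-cong g≡h (_ ∷ [])    = refl

  excessOf-cong : ∀ {g h : Flow n} → (∀ u v → g u v ≡ h u v) → ∀ L → excessOf g L ≡ excessOf h L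
  excessOf-cong g≡h (x ∷ y ∷ r) = cong₂ _-_ (g≡h x y) (leakOf-cong g≡h (y ∷ r))
  excessOf-cong g≡h []          = refl
  excessOf-cong g≡h (_ ∷ [])    = refl

  leakOf-⊕ : ∀ (g h : Flow n) L → leakOf (g ⊕ h) L ≡ leakOf g L + leakOf h L
  leakOf-⊕ g h (x ∷ y ∷ r) = begin
    sumOf ((g ⊕ h) x) (others y) + leakOf (g ⊕ h) (y ∷ r)
      ≡⟨ cong₂ _+_ (sumOf-+ (g x) (h x) (others y)) (leakOf-⊕ g h (y ∷ r)) ⟩
    (sumOf (g x) (others y) + sumOf (h x) (others y)) + (leakOf g (y ∷ r) + leakOf h (y ∷ r))
      ≡⟨ solve 4 (λ a b c d → (a :+ b) :+ (c :+ d) := (a :+ c) :+ (b :+ d)) refl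
           (sumOf (g x) (others y)) (sumOf (h x) (others y)) (leakOf g (y ∷ r)) (leakOf h (y ∷ r)) ⟩
    leakOf g (x ∷ y ∷ r) + leakOf h (x ∷ y ∷ r) ∎
    where open ≡-Reasoning
  leakOf-⊕ g h []       = sym (ℚ.+-identityˡ 0ℚ)
  leakOf-⊕ g h (_ ∷ []) = sym (ℚ.+-identityˡ 0ℚ)

  excessOf-⊕ : ∀ (g h : Flow n) L → excessOf (g ⊕ h) L ≡ excessOf g L + excessOf h L
  excessOf-⊕ g h (x ∷ y ∷ r) = begin
    (g x y + h x y) - leakOf (g ⊕ h) (y ∷ r)
      ≡⟨ cong (λ t → (g x y + h x y) - t) (leakOf-⊕ g h (y ∷ r)) ⟩
    (g x y + h x y) - (leakOf g (y ∷ r) + leakOf h (y ∷ r))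
      ≡⟨ solve 4 (λ a b c d → (a :+ b) :- (c :+ d) := (a :- c) :+ (b :- d)) refl
           (g x y) (h x y) (leakOf g (y ∷ r)) (leakOf h (y ∷ r)) ⟩
    excessOf g (x ∷ y ∷ r) + excessOf h (x ∷ y ∷ r) ∎
    where open ≡-Reasoning
  excessOf-⊕ g h []       = sym (ℚ.+-identityˡ 0ℚ)
  excessOf-⊕ g h (_ ∷ []) = sym (ℚ.+-identityˡ 0ℚ)

  leakOf-nonneg : ∀ {g : Flow n} → (∀ u v → 0ℚ ≤ g u v) → ∀ L → 0ℚ ≤ leakOf g L
  leakOf-nonneg g≥0 (x ∷ y ∷ r) = ℚ.+-mono-≤ (sumOf-nonneg (others y) (g≥0 x)) (leakOf-nonneg g≥0 (y ∷ r))
  leakOf-nonneg g≥0 []          = ℚ.≤-refl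
  leakOf-nonneg g≥0 (_ ∷ [])    = ℚ.≤-refl

  excessOf-≤-first : ∀ {g : Flow n} → (∀ u v → 0ℚ ≤ g u v) → ∀ x y r → excessOf g (x ∷ y ∷ r) ≤ g x y
  excessOf-≤-first g≥0 x y r = p-q≤p (leakOf-nonneg g≥0 (y ∷ r))

  weightOn : List (Fin n) → List (Fin n) × ℚ → ℚ
  weightOn P (q , w) with infix? _≟_ P q
  ... | yes _ = w
  ... | no  _ = 0ℚ

  weightOn-∈ : ∀ {P q} w → Infix _≡_ P q → weightOn P (q , w) ≡ w
  weightOn-∈ {P} {q} w P⊆q with infix? _≟_ P q
  ... | yes _   = refl
  ... | no P⊈q = ⊥-elim (P⊈q P⊆q)

  weightOn-∉ : ∀ {P q} w → ¬ Infix _≡_ P q → weightOn P (q , w) ≡ 0ℚ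
  weightOn-∉ {P} {q} w P⊈q with infix? _≟_ P q
  ... | yes P⊆q = ⊥-elim (P⊈q P⊆q)
  ... | no  _   = refl

  weightOn-nonneg : ∀ P q {w} → 0ℚ ≤ w → 0ℚ ≤ weightOn P (q , w)
  weightOn-nonneg P q 0≤w with infix? _≟_ P q
  ... | yes _ = 0≤w
  ... | no  _ = ℚ.≤-refl

  pathFlow : List (Fin n) → ℚ → Flow n
  pathFlow q w u v = weightOn (u ∷ v ∷ []) (q , w)

  inflow-pathFlow : ∀ {Q v} w → Unique Q → v ∈ Q → head Q ≢ just v → inflow (pathFlow Q w) v ≡ w
  inflow-pathFlow {a ∷ _} w _  (here refl) v≢head = ⊥-elim (v≢head refl)
  inflow-pathFlow {a ∷ _} w Q! (there v∈R) _ with predecessor-exists {a = a} v∈R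
  ... | p , p⟶v = trans
    (sumOf-≡-single (allFin⁺ n) (∈-allFin p)
      (λ _ u≢p → weightOn-∉ w (λ u⟶v → u≢p (predecessor-unique Q! u⟶v p⟶v))))
    (weightOn-∈ w p⟶v)

  outflow-pathFlow : ∀ {Q v} w → Unique Q → v ∈ Q → last Q ≢ just v → outflow (pathFlow Q w) v ≡ w
  outflow-pathFlow w Q! v∈Q v≢last with successor-exists v∈Q v≢last
  ... | s , v⟶s = trans
    (sumOf-≡-single (allFin⁺ n) (∈-allFin s)
      (λ _ u≢s → weightOn-∉ w (λ v⟶u → u≢s (successor-unique Q! v⟶u v⟶s))))
    (weightOn-∈ w v⟶s)

  open DecMembership (_≟_ {n}) using (_∈?_)

  pathFlow-conserved : ∀ {Q v} w → Unique Q → head Q ≢ just v → last Q ≢ just v →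
                       inflow (pathFlow Q w) v ≡ outflow (pathFlow Q w) v
  pathFlow-conserved {Q} {v} w Q! v≢head v≢last with v ∈? Q
  ... | yes v∈Q = trans (inflow-pathFlow w Q! v∈Q v≢head) (sym (outflow-pathFlow w Q! v∈Q v≢last))
  ... | no  v∉Q = trans (sumOf-≡0 (allFin n) (λ _ → weightOn-∉ w (v∉Q ∘′ Infix⇒∈ ∘′ Infix-∷⁻)))
                   (sym (sumOf-≡0 (allFin n) (λ _ → weightOn-∉ w (v∉Q ∘′ Infix⇒∈))))

  weightOn-mono : ∀ {L L′ q w} → 0ℚ ≤ w → (Infix _≡_ L q → Infix _≡_ L′ q) →
                  weightOn L (q , w) ≤ weightOn L′ (q , w)
  weightOn-mono {L} {L′} {q} {w} 0≤w L⇒L′ = by-cases (infix? _≟_ L q)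
    where
    by-cases : Dec (Infix _≡_ L q) → weightOn L (q , w) ≤ weightOn L′ (q , w)
    by-cases (yes L⊆q) = ℚ.≤-reflexive (trans (weightOn-∈ w L⊆q) (sym (weightOn-∈ w (L⇒L′ L⊆q))))
    by-cases (no  L⊈q) = subst (_≤ weightOn L′ (q , w)) (sym (weightOn-∉ w L⊈q)) (weightOn-nonneg L′ q 0≤w)

  Positive : Flow n → Fin n → Fin n → Set
  Positive g u v = 0ℚ < g u v

  bottleneck : Flow n → List (Fin n) → ℚ
  bottleneck g (x ∷ y ∷ [])    = g x y
  bottleneck g (x ∷ y ∷ z ∷ r) = g x y ⊓ bottleneck g (y ∷ z ∷ r)
  bottleneck g _               = 0ℚ

  bottleneck-≤ : ∀ g {Q a b} → a ⟶ b ∈ Q → bottleneck g Q ≤ g a b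
  bottleneck-≤ g {x ∷ y ∷ []}    (here (refl ∷ refl ∷ [])) = ℚ.≤-refl
  bottleneck-≤ g {x ∷ y ∷ z ∷ r} (here (refl ∷ refl ∷ [])) = ℚ.p⊓q≤p (g x y) _
  bottleneck-≤ g {x ∷ y ∷ z ∷ r} (there i) =
    ℚ.≤-trans (ℚ.p⊓q≤q (g x y) _) (bottleneck-≤ g {y ∷ z ∷ r} i)
  bottleneck-≤ g {x ∷ y ∷ []}    (there (here (_ ∷ ())))
  bottleneck-≤ g {x ∷ y ∷ []}    (there (there (here ())))
  bottleneck-≤ g {x ∷ []}        (here (_ ∷ ()))
  bottleneck-≤ g {x ∷ []}        (there (here ()))

  bottleneck-attained : ∀ g {Q a b} → a ⟶ b ∈ Q → ∃₂ λ s t → s ⟶ t ∈ Q × g s t ≡ bottleneck g Q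
  bottleneck-attained g {x ∷ y ∷ r} _ = attained x y r
    where
    attained : ∀ x y r → ∃₂ λ s t → s ⟶ t ∈ x ∷ y ∷ r × g s t ≡ bottleneck g (x ∷ y ∷ r)
    attained x y []      = x , y , here (refl ∷ refl ∷ []) , refl
    attained x y (z ∷ r) with attained y z r | ℚ.⊓-sel (g x y) (bottleneck g (y ∷ z ∷ r))
    ... | _                   | inj₁ min≡gxy  = x , y , here (refl ∷ refl ∷ []) , sym min≡gxy
    ... | s , t , s⟶t , gst≡ | inj₂ min≡rest = s , t , there s⟶t , trans gst≡ (sym min≡rest)
  bottleneck-attained g {[]}     (here ())
  bottleneck-attained g {x ∷ []} (here (_ ∷ ()))
  bottleneck-attained g {x ∷ []} (there (here ()))

  NoLeak : Flow n → List (Fin n) → Set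
  NoLeak g (y ∷ z ∷ S) = (∀ x → x ≢ z → ¬ Positive g y x) × NoLeak g (z ∷ S)
  NoLeak g _           = ⊤

  data LastLeak (g : Flow n) : List (Fin n) → Set where
    leak-here  : ∀ {y z S} x → x ≢ z → Positive g y x → NoLeak g (z ∷ S) → LastLeak g (y ∷ z ∷ S)
    leak-later : ∀ {y z S} → LastLeak g (z ∷ S) → LastLeak g (y ∷ z ∷ S)

  -- For a leak of y ∷ S: the vertices after y along S up to the leaking vertex, then the vertex the flow leaks to.
  detour : ∀ {g S} → LastLeak g S → List (Fin n)
  detour (leak-here x _ _ _)     = x ∷ []
  detour (leak-later {z = z} l) = z ∷ detour l

  noLeak-or-lastLeak : ∀ g S → NoLeak g S ⊎ LastLeak g S
  noLeak-or-lastLeak g []          = inj₁ tt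
  noLeak-or-lastLeak g (y ∷ [])    = inj₁ tt
  noLeak-or-lastLeak g (y ∷ z ∷ S) with noLeak-or-lastLeak g (z ∷ S)
  ... | inj₂ l = inj₂ (leak-later l)
  ... | inj₁ none-later with any? (λ x → ¬? (x ≟ z) ×-dec (0ℚ ℚ.<? g y x))
  ...   | yes (x , x≢z , y⟶x) = inj₂ (leak-here x x≢z y⟶x none-later)
  ...   | no  ∄leak           = inj₁ ((λ x x≢z y⟶x → ∄leak (x , x≢z , y⟶x)) , none-later)

  detour-walk : ∀ {g y S} (l : LastLeak g (y ∷ S)) → IsWalk (Positive g) (y ∷ S) → IsWalk (Positive g) (y ∷ detour l)
  detour-walk (leak-here _ _ y⟶x _) _         = y⟶x , tt
  detour-walk (leak-later l)         (e , wlk) = e , detour-walk l wlk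

  leakOf-noLeak : ∀ {g h} S → NoLeak g S → (∀ {y x} → ¬ Positive g y x → h y x ≡ 0ℚ) → leakOf h S ≡ 0ℚ
  leakOf-noLeak (y ∷ z ∷ S) (none-here , none-later) h⊆g = trans
    (cong₂ _+_ (sumOf-≡0 (others z) λ x∈ → h⊆g (none-here _ (∈-others⁻ x∈)))
               (leakOf-noLeak (z ∷ S) none-later h⊆g))
    (ℚ.+-identityˡ 0ℚ)
  leakOf-noLeak []       _ _ = refl
  leakOf-noLeak (_ ∷ []) _ _ = refl

  leakOf-pathFlow-detour : ∀ {g Q ε y S} → Unique Q → (∀ {u v} → ¬ Positive g u v → pathFlow Q ε u v ≡ 0ℚ) →
    (l : LastLeak g (y ∷ S)) → Infix _≡_ (y ∷ detour l) Q → leakOf (pathFlow Q ε) (y ∷ S) ≡ ε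
  leakOf-pathFlow-detour {Q = Q} {ε} {y} Q! χ⊆g (leak-here {z = z} {S} x x≢z _ none-later) y⟶x = begin
    sumOf (pathFlow Q ε y) (others z) + leakOf (pathFlow Q ε) (z ∷ S)
      ≡⟨ cong₂ _+_ out-of-y (leakOf-noLeak (z ∷ S) none-later χ⊆g) ⟩
    ε + 0ℚ
      ≡⟨ ℚ.+-identityʳ ε ⟩
    ε ∎
    where
    open ≡-Reasoning
    out-of-y : sumOf (pathFlow Q ε y) (others z) ≡ ε
    out-of-y = trans
      (sumOf-≡-single (others-unique z) (∈-others⁺ x≢z)
        (λ _ v≢x → weightOn-∉ ε (λ y⟶v → v≢x (successor-unique Q! y⟶v y⟶x))))
      (weightOn-∈ ε y⟶x)
  leakOf-pathFlow-detour {Q = Q} {ε} {y} Q! χ⊆g (leak-later {z = z} {S} l) y⟶z⟶ = begin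
    sumOf (pathFlow Q ε y) (others z) + leakOf (pathFlow Q ε) (z ∷ S)
      ≡⟨ cong₂ _+_ out-of-y (leakOf-pathFlow-detour Q! χ⊆g l (Infix-∷⁻ y⟶z⟶)) ⟩
    0ℚ + ε
      ≡⟨ ℚ.+-identityˡ ε ⟩
    ε ∎
    where
    open ≡-Reasoning
    out-of-y : sumOf (pathFlow Q ε y) (others z) ≡ 0ℚ
    out-of-y = sumOf-≡0 (others z) λ v∈ → weightOn-∉ ε λ y⟶v →
      ∈-others⁻ v∈ (successor-unique Q! y⟶v (Infix⇒⟶ y⟶z⟶))

  detour-⊈ : ∀ {g Q y S} → Unique Q → (l : LastLeak g (y ∷ S)) →
             Infix _≡_ (y ∷ detour l) Q → ¬ Infix _≡_ (y ∷ S) Q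
  detour-⊈ Q! (leak-here x x≢z _ _) y⟶x   y∷S⊆Q = x≢z (successor-unique Q! y⟶x (Infix⇒⟶ y∷S⊆Q))
  detour-⊈ Q! (leak-later l)        y∷l⊆Q y∷S⊆Q = detour-⊈ Q! l (Infix-∷⁻ y∷l⊆Q) (Infix-∷⁻ y∷S⊆Q)

  pairs : List (Fin n × Fin n)
  pairs = cartesianProduct (allFin n) (allFin n)

  positive? : ∀ g → U.Decidable λ (e : Fin n × Fin n) → Positive g (proj₁ e) (proj₂ e)
  positive? g (u , v) = 0ℚ ℚ.<? g u v

  support : Flow n → ℕ
  support g = length (filter (positive? g) pairs)

  support-< : ∀ {g h} → (∀ {u v} → Positive h u v → Positive g u v) →
              ∀ {a b} → Positive g a b → ¬ Positive h a b → support h ℕ.< support g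
  support-< {g} {h} h⊆g {a} {b} g-ab ¬h-ab =
    length-filter-< (positive? h) (positive? g) h⊆g (∈-cartesianProduct⁺ (∈-allFin a) (∈-allFin b)) g-ab ¬h-ab

module PathFlowBound {n : ℕ} {E : Fin n → Fin n → Set} {q : List (Fin n)} {w : ℚ} (0≤w : 0ℚ ≤ w)
                     (stuck-at-end : ∀ {t z} → Suffix _≡_ (t ∷ []) q → ¬ E t z) where

  pathFlow-nonneg : ∀ u v → 0ℚ ≤ pathFlow q w u v
  pathFlow-nonneg u v = weightOn-nonneg (u ∷ v ∷ []) q 0≤w

  follow : ∀ {y R rp} → Suffix _≡_ (y ∷ R) q → IsWalk E (y ∷ rp) →
           Prefix _≡_ rp R ⊎ w ≤ leakOf (pathFlow q w) (y ∷ rp)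
  follow {rp = []}                    _ _       = inj₁ []
  follow {R = []}     {rp = z ∷ _}    s (e , _) = ⊥-elim (stuck-at-end s e)
  follow {y} {x ∷ R} {z ∷ rp} s (_ , wlk) with x ≟ z
  ... | yes refl = Sum.map (refl ∷_) (λ w≤leak → ℚ.≤-trans w≤leak leak-≤) (follow (Suffix.tail s) wlk)
    where
    leak-≤ : leakOf (pathFlow q w) (x ∷ rp) ≤ leakOf (pathFlow q w) (y ∷ x ∷ rp)
    leak-≤ = q≤p+q (sumOf-nonneg (others x) (pathFlow-nonneg y))
  ... | no x≢z = inj₂ (begin
    w                                        ≡⟨ sym (weightOn-∈ w (Suffix⇒⟶ s)) ⟩
    pathFlow q w y x                         ≤⟨ ≤-sumOf (pathFlow-nonneg y) (∈-others⁺ x≢z) ⟩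
    sumOf (pathFlow q w y) (others z)        ≤⟨ p≤p+q (leakOf-nonneg pathFlow-nonneg (z ∷ rp)) ⟩
    leakOf (pathFlow q w) (y ∷ z ∷ rp)       ∎)
    where open ℚ.≤-Reasoning

  excessOf-pathFlow-≤ : ∀ u₁ u₂ rp → IsWalk E (u₁ ∷ u₂ ∷ rp) →
                        excessOf (pathFlow q w) (u₁ ∷ u₂ ∷ rp) ≤ weightOn (u₁ ∷ u₂ ∷ rp) (q , w)
  excessOf-pathFlow-≤ u₁ u₂ rp (_ , wlk) = by-cases (infix? _≟_ (u₁ ∷ u₂ ∷ []) q)
    where
    P : List (Fin n)
    P = u₁ ∷ u₂ ∷ rp

    excess≤first : excessOf (pathFlow q w) P ≤ pathFlow q w u₁ u₂
    excess≤first = excessOf-≤-first pathFlow-nonneg u₁ u₂ rp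

    by-cases : Dec (u₁ ⟶ u₂ ∈ q) → excessOf (pathFlow q w) P ≤ weightOn P (q , w)
    by-cases (no u₁⟶u₂∉q) = ℚ.≤-trans excess≤first
      (ℚ.≤-trans (ℚ.≤-reflexive (weightOn-∉ w u₁⟶u₂∉q)) (weightOn-nonneg P q 0≤w))
    by-cases (yes u₁⟶u₂) with ⟶⇒Suffix u₁⟶u₂
    ... | R , s with follow (Suffix.tail s) wlk
    ...   | inj₁ rp≼R = ℚ.≤-trans excess≤first (ℚ.≤-reflexive (trans (weightOn-∈ w u₁⟶u₂)
                          (sym (weightOn-∈ w (fromPrefixSuffix trans (refl ∷ refl ∷ rp≼R) s)))))
    ...   | inj₂ w≤leak = ℚ.≤-trans
      (ℚ.≤-trans (ℚ.≤-reflexive (cong (_- leakOf (pathFlow q w) (u₂ ∷ rp)) (weightOn-∈ w u₁⟶u₂)))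
                 (p≤q⇒p-q≤0 w≤leak))
      (weightOn-nonneg P q 0≤w)

module _ {n : ℕ} (G : FlowGraph n) where

  open FlowGraph G

  WeightedPaths : Set
  WeightedPaths = List (List (Fin n) × ℚ)

  ValidPaths : WeightedPaths → Set
  ValidPaths = All (λ q → IsSourceSinkPath G (proj₁ q) × 0ℚ < proj₂ q)

  decompositionFlow : WeightedPaths → Flow n
  decompositionFlow D u v = weightContaining G D (u ∷ v ∷ [])

  weightContaining-∷ : ∀ q w D P →
    weightContaining G ((q , w) ∷ D) P ≡ weightOn P (q , w) + weightContaining G D P
  weightContaining-∷ q w D P with infix? _≟_ P q
  ... | yes _ = refl
  ... | no  _ = sym (ℚ.+-identityˡ _)

  excessFlow≡excessOf : ∀ P → excessFlow G P ≡ excessOf f P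
  excessFlow≡excessOf (x ∷ y ∷ r) = cong (λ t → f x y - t) (leak≡leakOf (y ∷ r))
    where
    leak≡leakOf : ∀ L → leak G L ≡ leakOf f L
    leak≡leakOf (x ∷ y ∷ r) = cong (outExcept G x y +_) (leak≡leakOf (y ∷ r))
    leak≡leakOf []          = refl
    leak≡leakOf (_ ∷ [])    = refl
  excessFlow≡excessOf []       = refl
  excessFlow≡excessOf (_ ∷ []) = refl

  sink-stuck : ∀ {t z} → IsSink t → ¬ Edge t z
  sink-stuck {t} {z} t-sink t⟶z =
    ℚ.<-irrefl refl (ℚ.<-≤-trans t⟶z (ℚ.≤-trans (≤-sumOf (nonneg t) (∈-allFin z)) (ℚ.≤-reflexive t-sink)))

  excessOf-decomposition-≤ : ∀ {D} → ValidPaths D → ∀ u₁ u₂ rp → IsWalk Edge (u₁ ∷ u₂ ∷ rp) →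
    excessOf (decompositionFlow D) (u₁ ∷ u₂ ∷ rp) ≤ weightContaining G D (u₁ ∷ u₂ ∷ rp)
  excessOf-decomposition-≤ []                          u₁ u₂ rp _   =
    excessOf-≤-first (λ _ _ → ℚ.≤-refl) u₁ u₂ rp
  excessOf-decomposition-≤ {(q , w) ∷ D} ((q-path , 0<w) ∷ valid) u₁ u₂ rp wlk = begin
    excessOf (decompositionFlow ((q , w) ∷ D)) P
      ≡⟨ excessOf-cong (λ u v → weightContaining-∷ q w D (u ∷ v ∷ [])) P ⟩
    excessOf (pathFlow q w ⊕ decompositionFlow D) P
      ≡⟨ excessOf-⊕ (pathFlow q w) (decompositionFlow D) P ⟩
    excessOf (pathFlow q w) P + excessOf (decompositionFlow D) P
      ≤⟨ ℚ.+-mono-≤ (PathFlowBound.excessOf-pathFlow-≤ (ℚ.<⇒≤ 0<w) stuck u₁ u₂ rp wlk)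
                    (excessOf-decomposition-≤ valid u₁ u₂ rp wlk) ⟩
    weightOn P (q , w) + weightContaining G D P
      ≡⟨ sym (weightContaining-∷ q w D P) ⟩
    weightContaining G ((q , w) ∷ D) P ∎
    where
    open ℚ.≤-Reasoning
    P : List (Fin n)
    P = u₁ ∷ u₂ ∷ rp
    stuck : ∀ {t z} → Suffix _≡_ (t ∷ []) q → ¬ Edge t z
    stuck t-last = sink-stuck (proj₂ (proj₂ q-path) _ (Suffix⇒last t-last))

  safe-if-excess : ∀ {w} u₁ u₂ rp → IsWalk Edge (u₁ ∷ u₂ ∷ rp) →
                   w ≤ excessFlow G (u₁ ∷ u₂ ∷ rp) → WSafe G w (u₁ ∷ u₂ ∷ rp)
  safe-if-excess u₁ u₂ rp wlk w≤excess D (valid , f≡D) = begin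
    _                                       ≤⟨ w≤excess ⟩
    excessFlow G (u₁ ∷ u₂ ∷ rp)             ≡⟨ excessFlow≡excessOf (u₁ ∷ u₂ ∷ rp) ⟩
    excessOf f (u₁ ∷ u₂ ∷ rp)               ≡⟨ excessOf-cong f≡D (u₁ ∷ u₂ ∷ rp) ⟩
    excessOf (decompositionFlow D) (u₁ ∷ u₂ ∷ rp) ≤⟨ excessOf-decomposition-≤ valid u₁ u₂ rp wlk ⟩
    weightContaining G D (u₁ ∷ u₂ ∷ rp)     ∎
    where open ℚ.≤-Reasoning

  source-unreachable : ∀ {t z} → IsSource z → ¬ Edge t z
  source-unreachable {t} {z} z-source t⟶z =
    ℚ.<-irrefl refl (ℚ.<-≤-trans t⟶z
      (ℚ.≤-trans (≤-sumOf (λ u → nonneg u z) (∈-allFin t)) (ℚ.≤-reflexive z-source)))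

  _⤳_ : Fin n → Fin n → Set
  _⤳_ = TransClosure Edge

  ⤳⇒walk : ∀ {x y} → x ⤳ y → ∃ λ W → IsWalk Edge (x ∷ (W ++ y ∷ []))
  ⤳⇒walk [ x⟶y ]                = [] , x⟶y , tt
  ⤳⇒walk (_∷_ {y = y} x⟶y y⤳z) with ⤳⇒walk y⤳z
  ... | W , wlk = y ∷ W , x⟶y , wlk

  ⤳-irrefl : ∀ {x} → ¬ x ⤳ x
  ⤳-irrefl {x} x⤳x with ⤳⇒walk x⤳x
  ... | W , closed = acyclic x W closed

  ⤳-isStrictPartialOrder : IsStrictPartialOrder _≡_ _⤳_
  ⤳-isStrictPartialOrder = record
    { isEquivalence = isEquivalence
    ; irrefl        = λ { refl → ⤳-irrefl }
    ; trans         = TransClosure._++_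
    ; <-resp-≈      = (λ { refl x⤳y → x⤳y }) , (λ { refl x⤳y → x⤳y })
    }

  Edge-wellFounded : WellFounded Edge
  Edge-wellFounded = TransClosure.wellFounded⁻ Edge (spo-wellFounded ⤳-isStrictPartialOrder)

  Edge-noetherian : WellFounded (flip Edge)
  Edge-noetherian = Subrelation.wellFounded [_] (spo-noetherian ⤳-isStrictPartialOrder)

  walk-reaches : ∀ {x R} → IsWalk Edge (x ∷ R) → ∀ {y} → y ∈ R → x ⤳ y
  walk-reaches {R = _ ∷ _} (x⟶r , _)   (here refl) = [ x⟶r ]
  walk-reaches {R = _ ∷ _} (x⟶r , wlk) (there y∈R) = x⟶r ∷ walk-reaches wlk y∈R

  walk-unique : ∀ {Q} → IsWalk Edge Q → Unique Q
  walk-unique {_ ∷ []}    _   = [] ∷ []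
  walk-unique {x ∷ _ ∷ _} wlk =
    All.tabulate (λ y∈R x≡y → ⤳-irrefl (subst (x ⤳_) (sym x≡y) (walk-reaches wlk y∈R))) ∷ walk-unique (proj₂ wlk)

  record SubFlow (g : Flow n) : Set where
    field
      nonneg-sub : ∀ u v → 0ℚ ≤ g u v
      ≤-flow     : ∀ u v → g u v ≤ f u v
      conserved  : ∀ v → ¬ IsSource v → ¬ IsSink v → inflow g v ≡ outflow g v

  f-subFlow : SubFlow f
  f-subFlow = record { nonneg-sub = nonneg ; ≤-flow = λ _ _ → ℚ.≤-refl ; conserved = conservation }

  StartsAtSource EndsAtSink : List (Fin n) → Set
  StartsAtSource Q = ∀ s → head Q ≡ just s → IsSource s
  EndsAtSink     Q = ∀ t → last Q ≡ just t → IsSink t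

  IsSourceSinkWalk : Flow n → List (Fin n) → Set
  IsSourceSinkWalk g Q = IsWalk (Positive g) Q × StartsAtSource Q × EndsAtSink Q

  record PathThrough (g : Flow n) (M : List (Fin n)) : Set where
    field
      path        : List (Fin n)
      source-sink : IsSourceSinkWalk g path
      through     : Infix _≡_ M path

  module Extension {g} (sub : SubFlow g) where

    open SubFlow sub

    positive⇒edge : ∀ {u v} → Positive g u v → Edge u v
    positive⇒edge {u} {v} 0<g = ℚ.<-≤-trans 0<g (≤-flow u v)

    continue-out : ∀ {x y} → Positive g x y → ¬ IsSink y → ∃ λ z → Positive g y z
    continue-out {x} {y} x⟶y ¬y-sink = sumOf-pos⇒term-pos (allFin n) (subst (0ℚ <_)
      (conserved y (λ y-source → source-unreachable y-source (positive⇒edge x⟶y)) ¬y-sink)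
      (ℚ.<-≤-trans x⟶y (≤-sumOf (λ u → nonneg-sub u y) (∈-allFin x))))

    continue-in : ∀ {y z} → Positive g y z → ¬ IsSource y → ∃ λ x → Positive g x y
    continue-in {y} {z} y⟶z ¬y-source = sumOf-pos⇒term-pos (allFin n) (subst (0ℚ <_)
      (sym (conserved y ¬y-source (λ y-sink → sink-stuck y-sink (positive⇒edge y⟶z))))
      (ℚ.<-≤-trans y⟶z (≤-sumOf (nonneg-sub y) (∈-allFin z))))

    to-sink : ∀ {x y} → Acc (flip Edge) y → Positive g x y →
              ∃ λ B → IsWalk (Positive g) (y ∷ B) × EndsAtSink (y ∷ B)
    to-sink {y = y} (acc rec) x⟶y with fout y ℚ.≟ 0ℚ
    ... | yes y-sink = [] , tt , λ { _ refl → y-sink }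
    ... | no ¬y-sink with continue-out x⟶y ¬y-sink
    ...   | z , y⟶z with to-sink (rec (positive⇒edge y⟶z)) y⟶z
    ...     | B , wlk , ends = z ∷ B , (y⟶z , wlk) , ends

    to-source : ∀ {x y} → Acc Edge x → ∀ L → IsWalk (Positive g) (x ∷ y ∷ L) → EndsAtSink (x ∷ y ∷ L) →
                ∃ λ A → IsSourceSinkWalk g (A ++ x ∷ y ∷ L)
    to-source {x} {y} (acc rec) L wlk ends with fin x ℚ.≟ 0ℚ
    ... | yes x-source = [] , wlk , (λ { _ refl → x-source }) , ends
    ... | no ¬x-source with continue-in (proj₁ wlk) ¬x-source
    ...   | p , p⟶x with to-source (rec (positive⇒edge p⟶x)) (y ∷ L) (p⟶x , wlk) ends
    ...     | A , Q-ok = A ++ p ∷ [] , subst (IsSourceSinkWalk g) (sym (++-assoc A (p ∷ []) (x ∷ y ∷ L))) Q-ok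

    to-sink-from : ∀ {a b M} → IsWalk (Positive g) (a ∷ b ∷ M) →
                   ∃ λ B → IsWalk (Positive g) (a ∷ b ∷ M ++ B) × EndsAtSink (a ∷ b ∷ M ++ B)
    to-sink-from {b = b} {[]} (a⟶b , _) with to-sink (Edge-noetherian b) a⟶b
    ... | B , wlk , ends = B , (a⟶b , wlk) , ends
    to-sink-from {M = _ ∷ _} (a⟶b , wlk) with to-sink-from wlk
    ... | B , wlk′ , ends = B , (a⟶b , wlk′) , ends

    extend : ∀ {a b M} → IsWalk (Positive g) (a ∷ b ∷ M) → PathThrough g (a ∷ b ∷ M)
    extend {a} {b} {M} wlk with to-sink-from wlk
    ... | B , wlk′ , ends with to-source (Edge-wellFounded a) (M ++ B) wlk′ ends
    ...   | A , Q-ok = record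
      { path        = A ++ a ∷ b ∷ M ++ B
      ; source-sink = Q-ok
      ; through     = A ++ⁱ here (Prefix-++ (a ∷ b ∷ M) B)
      }

  record DecompositionOf (g : Flow n) : Set where
    field
      paths   : WeightedPaths
      valid   : ValidPaths paths
      sums-to : ∀ u v → g u v ≡ decompositionFlow paths u v

  module Peel {g} (sub : SubFlow g) {a b Q} (Q-ok : IsSourceSinkWalk g Q) (a⟶b : a ⟶ b ∈ Q) where

    open SubFlow sub
    open Extension sub using (positive⇒edge)

    ε : ℚ
    ε = bottleneck g Q

    rest : Flow n
    rest u v = g u v - pathFlow Q ε u v

    Q-edges : IsWalk Edge Q
    Q-edges = IsWalk-map positive⇒edge (proj₁ Q-ok)

    Q-unique : Unique Q
    Q-unique = walk-unique Q-edges

    ε-positive : 0ℚ < ε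
    ε-positive with bottleneck-attained g a⟶b
    ... | s , t , s⟶t , gst≡ε = subst (0ℚ <_) gst≡ε (IsWalk-⟶ (proj₁ Q-ok) s⟶t)

    pathFlow-nonneg : ∀ u v → 0ℚ ≤ pathFlow Q ε u v
    pathFlow-nonneg u v = weightOn-nonneg (u ∷ v ∷ []) Q (ℚ.<⇒≤ ε-positive)

    pathFlow-⊆ : ∀ {u v} → ¬ Positive g u v → pathFlow Q ε u v ≡ 0ℚ
    pathFlow-⊆ ¬g-uv = weightOn-∉ ε (¬g-uv ∘′ IsWalk-⟶ (proj₁ Q-ok))

    g≡pathFlow⊕rest : ∀ u v → g u v ≡ (pathFlow Q ε ⊕ rest) u v
    g≡pathFlow⊕rest u v = solve 2 (λ x y → x := y :+ (x :- y)) refl (g u v) (pathFlow Q ε u v)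

    rest-nonneg : ∀ u v → 0ℚ ≤ rest u v
    rest-nonneg u v = by-cases (infix? _≟_ (u ∷ v ∷ []) Q)
      where
      by-cases : Dec (u ⟶ v ∈ Q) → 0ℚ ≤ rest u v
      by-cases (yes u⟶v) = subst (λ t → 0ℚ ≤ g u v - t) (sym (weightOn-∈ ε u⟶v))
                             (p≤q⇒0≤q-p (bottleneck-≤ g u⟶v))
      by-cases (no  u⟶v∉) = subst (λ t → 0ℚ ≤ g u v - t) (sym (weightOn-∉ ε u⟶v∉))
                             (subst (0ℚ ≤_) (sym (ℚ.+-identityʳ (g u v))) (nonneg-sub u v))

    rest-conserved : ∀ v → ¬ IsSource v → ¬ IsSink v → inflow rest v ≡ outflow rest v
    rest-conserved v ¬source ¬sink = ∙-cancelˡ (inflow (pathFlow Q ε) v) _ _ (begin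
      inflow (pathFlow Q ε) v + inflow rest v    ≡⟨ sym (sumOf-+ _ _ (allFin n)) ⟩
      inflow (pathFlow Q ε ⊕ rest) v             ≡⟨ sumOf-cong (allFin n) (λ u → sym (g≡pathFlow⊕rest u v)) ⟩
      inflow g v                                 ≡⟨ conserved v ¬source ¬sink ⟩
      outflow g v                                ≡⟨ sumOf-cong (allFin n) (g≡pathFlow⊕rest v) ⟩
      outflow (pathFlow Q ε ⊕ rest) v            ≡⟨ sumOf-+ (pathFlow Q ε v) (rest v) (allFin n) ⟩
      outflow (pathFlow Q ε) v + outflow rest v  ≡⟨ cong (_+ outflow rest v) (sym path-conserved) ⟩
      inflow (pathFlow Q ε) v + outflow rest v   ∎)
      where
      open ≡-Reasoning
      path-conserved : inflow (pathFlow Q ε) v ≡ outflow (pathFlow Q ε) v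
      path-conserved =
        pathFlow-conserved ε Q-unique (¬source ∘′ proj₁ (proj₂ Q-ok) v) (¬sink ∘′ proj₂ (proj₂ Q-ok) v)

    rest-subFlow : SubFlow rest
    rest-subFlow = record
      { nonneg-sub = rest-nonneg
      ; ≤-flow     = λ u v → ℚ.≤-trans (p-q≤p (pathFlow-nonneg u v)) (≤-flow u v)
      ; conserved  = rest-conserved
      }

    support-rest-< : support rest ℕ.< support g
    support-rest-< with bottleneck-attained g a⟶b
    ... | s , t , s⟶t , gst≡ε =
      support-< {g = g} {h = rest} rest⇒g (IsWalk-⟶ (proj₁ Q-ok) s⟶t)
        (ℚ.<-irrefl refl ∘′ subst (0ℚ <_) rest-st≡0)
      where
      rest⇒g : ∀ {u v} → Positive rest u v → Positive g u v
      rest⇒g {u} {v} 0<rest = ℚ.<-≤-trans 0<rest (p-q≤p (pathFlow-nonneg u v))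
      rest-st≡0 : rest s t ≡ 0ℚ
      rest-st≡0 = trans (cong₂ _-_ gst≡ε (weightOn-∈ ε s⟶t)) (ℚ.+-inverseʳ ε)

    excessOf-split : ∀ P → excessOf g P ≡ excessOf (pathFlow Q ε) P + excessOf rest P
    excessOf-split P = trans (excessOf-cong g≡pathFlow⊕rest P) (excessOf-⊕ (pathFlow Q ε) rest P)

    prepend : DecompositionOf rest → DecompositionOf g
    prepend D = record
      { paths   = (Q , ε) ∷ paths
      ; valid   = ((Q-edges , proj₂ Q-ok) , ε-positive) ∷ valid
      ; sums-to = λ u v → trans (g≡pathFlow⊕rest u v) (trans (cong (pathFlow Q ε u v +_) (sums-to u v))
                                                              (sym (weightContaining-∷ Q ε paths (u ∷ v ∷ []))))
      }
      where open DecompositionOf D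

  weightContaining-mono : ∀ {D L L′} → ValidPaths D → (∀ {q} → Infix _≡_ L q → Infix _≡_ L′ q) →
                          weightContaining G D L ≤ weightContaining G D L′
  weightContaining-mono {[]}          []                L⇒L′ = ℚ.≤-refl
  weightContaining-mono {(q , w) ∷ D} {L} {L′} ((_ , 0<w) ∷ valid) L⇒L′ = begin
    weightContaining G ((q , w) ∷ D) L             ≡⟨ weightContaining-∷ q w D L ⟩
    weightOn L (q , w) + weightContaining G D L    ≤⟨ ℚ.+-mono-≤ (weightOn-mono (ℚ.<⇒≤ 0<w) L⇒L′)
                                                                  (weightContaining-mono valid L⇒L′) ⟩
    weightOn L′ (q , w) + weightContaining G D L′  ≡⟨ sym (weightContaining-∷ q w D L′) ⟩
    weightContaining G ((q , w) ∷ D) L′            ∎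
    where open ℚ.≤-Reasoning

  module Construction (u₁ u₂ : Fin n) (rp : List (Fin n)) where

    P : List (Fin n)
    P = u₁ ∷ u₂ ∷ rp

    BoundedDecomposition : Flow n → ℚ → Set
    BoundedDecomposition g c = Σ (DecompositionOf g) λ D → weightContaining G (DecompositionOf.paths D) P ≤ c

    Decomposable : Flow n → Set
    Decomposable g = SubFlow g → ∀ {c} → 0ℚ ≤ c → excessOf g P ≤ c → BoundedDecomposition g c

    Smaller : Flow n → Set
    Smaller g = ∀ {h} → support h ℕ.< support g → Decomposable h

    peel-and-recurse : ∀ {g a b Q} → Smaller g → (sub : SubFlow g) (Q-ok : IsSourceSinkWalk g Q) (a⟶b : a ⟶ b ∈ Q) →
      let open Peel sub Q-ok a⟶b in
      ∀ {c c′} → 0ℚ ≤ c′ → excessOf rest P ≤ c′ → weightOn P (Q , ε) + c′ ≤ c → BoundedDecomposition g c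
    peel-and-recurse {Q = Q} smaller sub Q-ok a⟶b {c} {c′} 0≤c′ excess≤c′ bound = prepend D , (begin
      weightContaining G ((Q , ε) ∷ paths) P           ≡⟨ weightContaining-∷ Q ε paths P ⟩
      weightOn P (Q , ε) + weightContaining G paths P  ≤⟨ ℚ.+-monoʳ-≤ (weightOn P (Q , ε)) D≤c′ ⟩
      weightOn P (Q , ε) + c′                          ≤⟨ bound ⟩
      c                                                ∎)
      where
      open Peel sub Q-ok a⟶b
      open ℚ.≤-Reasoning
      recursive : BoundedDecomposition rest c′
      recursive = smaller support-rest-< rest-subFlow 0≤c′ excess≤c′
      D : DecompositionOf rest
      D = proj₁ recursive
      open DecompositionOf D
      D≤c′ : weightContaining G paths P ≤ c′
      D≤c′ = proj₂ recursive

    no-flow : ∀ {g c} → (∀ u v → ¬ Positive g u v) → SubFlow g → 0ℚ ≤ c → BoundedDecomposition g c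
    no-flow none sub 0≤c = record
      { paths   = []
      ; valid   = []
      ; sums-to = λ u v → ℚ.≤-antisym (ℚ.≮⇒≥ (none u v)) (SubFlow.nonneg-sub sub u v)
      } , 0≤c

    -- Any decomposition of g gives P weight at most g s t = 0.
    off-P : ∀ {g c a b s t} → Smaller g → SubFlow g → Positive g a b → ¬ Positive g s t → s ⟶ t ∈ P →
            0ℚ ≤ c → BoundedDecomposition g c
    off-P {g} {c} {s = s} {t} smaller sub a⟶b ¬s⟶t s⟶t∈P 0≤c = D , (begin
      weightContaining G paths P              ≤⟨ weightContaining-mono valid (Infix-trans trans s⟶t∈P) ⟩
      weightContaining G paths (s ∷ t ∷ [])   ≡⟨ sym (sums-to s t) ⟩
      g s t                                   ≤⟨ ℚ.≮⇒≥ ¬s⟶t ⟩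
      0ℚ                                      ≤⟨ 0≤c ⟩
      c                                       ∎)
      where
      open ℚ.≤-Reasoning
      route : PathThrough g (_ ∷ _ ∷ [])
      route = Extension.extend sub (a⟶b , tt)
      open PathThrough route
      open Peel sub source-sink through
      D : DecompositionOf g
      D = proj₁ (peel-and-recurse smaller sub source-sink through {c′ = 0ℚ ⊔ excessOf rest P}
                   (ℚ.p≤p⊔q 0ℚ (excessOf rest P)) (ℚ.p≤q⊔p 0ℚ (excessOf rest P)) ℚ.≤-refl)
      open DecompositionOf D

    along-P : ∀ {g c} → Smaller g → SubFlow g → IsWalk (Positive g) P → NoLeak g (u₂ ∷ rp) →
              0ℚ ≤ c → excessOf g P ≤ c → BoundedDecomposition g c
    along-P {g} {c} smaller sub P-walk none 0≤c excess≤c =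
      peel-and-recurse smaller sub source-sink u₁⟶u₂ (p≤q⇒0≤q-p ε≤c) excess-rest≤c-ε (ℚ.≤-reflexive bound)
      where
      route : PathThrough g P
      route = Extension.extend sub P-walk
      open PathThrough route
      u₁⟶u₂ : u₁ ⟶ u₂ ∈ path
      u₁⟶u₂ = Infix⇒⟶ through
      open Peel sub source-sink u₁⟶u₂

      excess-g : excessOf g P ≡ g u₁ u₂
      excess-g = trans (cong (λ t → g u₁ u₂ - t) (leakOf-noLeak (u₂ ∷ rp) none λ ¬pos →
                   ℚ.≤-antisym (ℚ.≮⇒≥ ¬pos) (SubFlow.nonneg-sub sub _ _))) (ℚ.+-identityʳ _)

      excess-path : excessOf (pathFlow path ε) P ≡ ε
      excess-path = trans (cong₂ _-_ (weightOn-∈ ε u₁⟶u₂) (leakOf-noLeak (u₂ ∷ rp) none pathFlow-⊆))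
                      (ℚ.+-identityʳ ε)

      ε≤c : ε ≤ c
      ε≤c = ℚ.≤-trans (bottleneck-≤ g u₁⟶u₂) (ℚ.≤-trans (ℚ.≤-reflexive (sym excess-g)) excess≤c)

      excess-rest≤c-ε : excessOf rest P ≤ c - ε
      excess-rest≤c-ε = p+q≤r⇒q≤r-p
        (subst (_≤ c) (trans (excessOf-split P) (cong (_+ excessOf rest P) excess-path)) excess≤c)

      bound : weightOn P (path , ε) + (c - ε) ≡ c
      bound = trans (cong (_+ (c - ε)) (weightOn-∈ ε through)) (solve 2 (λ e c → e :+ (c :- e) := c) refl ε c)

    -- The peeled path leaves P at its last leak, so it removes ε from both the first edge and the
    -- leaks of P, and the excess of P is unchanged.
    at-leak : ∀ {g c} → Smaller g → SubFlow g → IsWalk (Positive g) P → LastLeak g (u₂ ∷ rp) →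
              0ℚ ≤ c → excessOf g P ≤ c → BoundedDecomposition g c
    at-leak {g} {c} smaller sub (u₁⟶u₂ , rp-walk) l 0≤c excess≤c =
      peel-and-recurse smaller sub source-sink u₁⟶u₂∈Q 0≤c excess-rest≤c (ℚ.≤-reflexive bound)
      where
      route : PathThrough g (u₁ ∷ u₂ ∷ detour l)
      route = Extension.extend sub (u₁⟶u₂ , detour-walk l rp-walk)
      open PathThrough route
      u₁⟶u₂∈Q : u₁ ⟶ u₂ ∈ path
      u₁⟶u₂∈Q = Infix⇒⟶ through
      open Peel sub source-sink u₁⟶u₂∈Q

      detour⊆Q : Infix _≡_ (u₂ ∷ detour l) path
      detour⊆Q = Infix-∷⁻ through

      excess-path : excessOf (pathFlow path ε) P ≡ 0ℚ
      excess-path = trans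
        (cong₂ _-_ (weightOn-∈ ε u₁⟶u₂∈Q) (leakOf-pathFlow-detour Q-unique pathFlow-⊆ l detour⊆Q))
        (ℚ.+-inverseʳ ε)

      excess-rest≤c : excessOf rest P ≤ c
      excess-rest≤c = subst (_≤ c)
        (trans (excessOf-split P) (trans (cong (_+ excessOf rest P) excess-path) (ℚ.+-identityˡ _))) excess≤c

      bound : weightOn P (path , ε) + c ≡ c
      bound = trans (cong (_+ c) (weightOn-∉ ε (detour-⊈ Q-unique l detour⊆Q ∘′ Infix-∷⁻))) (ℚ.+-identityˡ c)

    decompose : ∀ g → Decomposable g
    decompose = WF.All.wfRec (On.wellFounded support ℕ.<-wellFounded) 0ℓ Decomposable step
      where
      step : ∀ g → Smaller g → Decomposable g
      step g smaller sub 0≤c excess≤c with walk-or-gap (λ u v → 0ℚ ℚ.<? g u v) u₁ (u₂ ∷ rp)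
      ... | inj₁ P-walk with noLeak-or-lastLeak g (u₂ ∷ rp)
      ...   | inj₁ none = along-P smaller sub P-walk none 0≤c excess≤c
      ...   | inj₂ l    = at-leak smaller sub P-walk l 0≤c excess≤c
      step g smaller sub 0≤c excess≤c | inj₂ (s , t , ¬s⟶t , s⟶t∈P)
        with any? (λ a → any? (λ b → 0ℚ ℚ.<? g a b))
      ... | yes (a , b , a⟶b) = off-P smaller sub a⟶b ¬s⟶t s⟶t∈P 0≤c
      ... | no  ∄flow         = no-flow (λ u v g-uv → ∄flow (u , v , g-uv)) sub 0≤c

  excess-if-safe : ∀ {w} u₁ u₂ rp → 0ℚ < w → WSafe G w (u₁ ∷ u₂ ∷ rp) →
                   w ≤ excessFlow G (u₁ ∷ u₂ ∷ rp)
  excess-if-safe {w} u₁ u₂ rp 0<w safe with w ℚ.≤? excessFlow G (u₁ ∷ u₂ ∷ rp)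
  ... | yes w≤excess = w≤excess
  ... | no  w≰excess =
    ⊥-elim (ℚ.<-irrefl refl (ℚ.≤-<-trans (ℚ.≤-trans (safe paths (valid , sums-to)) D≤c) c<w))
    where
    open Construction u₁ u₂ rp
    e : ℚ
    e = excessOf f P
    decomposition : BoundedDecomposition f (0ℚ ⊔ e)
    decomposition = decompose f f-subFlow (ℚ.p≤p⊔q 0ℚ e) (ℚ.p≤q⊔p 0ℚ e)
    open DecompositionOf (proj₁ decomposition)
    D≤c : weightContaining G paths P ≤ 0ℚ ⊔ e
    D≤c = proj₂ decomposition
    c<w : 0ℚ ⊔ e < w
    c<w with ℚ.⊔-sel 0ℚ e
    ... | inj₁ c≡0 = subst (_< w) (sym c≡0) 0<w
    ... | inj₂ c≡e = subst (_< w) (sym (trans c≡e (sym (excessFlow≡excessOf P)))) (ℚ.≰⇒> w≰excess)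

theorem1 : ∀ {n} (G : FlowGraph n) (P : List (Fin n)) (w : ℚ) →
    IsWalk (FlowGraph.Edge G) P → 2 ℕ.≤ length P → 0ℚ < w →
    (WSafe G w P ⇔ w ≤ excessFlow G P)
theorem1 G (u₁ ∷ u₂ ∷ rp) w P-walk _ 0<w =
  mk⇔ (excess-if-safe G u₁ u₂ rp 0<w) (safe-if-excess G u₁ u₂ rp P-walk)
theorem1 G (_ ∷ []) w _ (ℕ.s≤s ()) _
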